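{- For $\lambda\vdash n$, \[ \{\mathrm{des}(T):T\in\mathrm{SYT}(\lambda)\}=\{\lambda'_1-1,\lambda'_1,\dots,n-\lambda_1-1,n-\lambda_1\}. \] In particular, $\sum_{T\in\mathrm{SYT}(\lambda)}q^{\mathrm{des}(T)}$ has no internal zeros.
   Context: $\mathrm{SYT}(\lambda)$: standard Young tableaux of shape $\lambda$; $i$ is a descent of $T$ if $i+1$ lies in a strictly lower row than $i$, and $\mathrm{des}(T)$ is the number of descents. $\lambda'_1$ is the number of rows of $\lambda$, $\lambda_1$ the length of the first row. A polynomial $\sum c_iq^i$ has no internal zeros if $c_j\neq0$ whenever $c_i,c_k\neq0$ and $i<j<k$. -}

module Defs where

open import Data.Nat using (ℕ; zero; suc; _≤_; _<_; _<?_; _∸_)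
open import Data.Nat.Properties using (_≥?_)
open import Data.Fin using (Fin; toℕ; fromℕ<)
open import Data.List using (List; []; _∷_; length; lookup; upTo; filter)
open import Data.Nat.ListAction using (sum)
open import Data.List.Relation.Unary.All using (All)
open import Data.List.Relation.Unary.Linked using (Linked)
open import Data.Product using (Σ; _×_; proj₁; proj₂; ∃-syntax)
open import Data.Nat using (_≥_)
open import Function.Bundles using (_↔_; Inverse)
open import Relation.Nullary using (Dec; yes; no)
open import Relation.Nullary.Decidable using (_×-dec_)
open import Relation.Binary.PropositionalEquality using (_≡_)

record Partition (n : ℕ) : Set where
  constructor mkPartition
  field
    parts     : List ℕ
    positive  : All (λ p → 1 ≤ p) parts
    decreasing : Linked _≥_ parts
    sums      : sum parts ≡ n
open Partition public

numRows : ∀ {n} → Partition n → ℕ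
numRows λp = length (parts λp)

firstRow : ∀ {n} → Partition n → ℕ
firstRow λp with parts λp
... | []    = 0
... | p ∷ _ = p

Cell : ∀ {n} → Partition n → Set
Cell λp = Σ (Fin (length (parts λp))) (λ i → Fin (lookup (parts λp) i))

row : ∀ {n} (λp : Partition n) → Cell λp → ℕ
row λp c = toℕ (proj₁ c)

col : ∀ {n} (λp : Partition n) → Cell λp → ℕ
col λp c = toℕ (proj₂ c)

-- A standard Young tableau of shape λ: a bijection from the cells onto the
-- entries {0,…,n-1} (entries shifted by one from the usual {1,…,n}),
-- strictly increasing along rows and down columns.
record SYT {n : ℕ} (λp : Partition n) : Set where
  constructor mkSYT
  field
    filling : Cell λp ↔ Fin n
    rowIncreasing : ∀ (c c′ : Cell λp) → row λp c ≡ row λp c′ → col λp c < col λp c′ →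
      toℕ (Inverse.to filling c) < toℕ (Inverse.to filling c′)
    colIncreasing : ∀ (c c′ : Cell λp) → col λp c ≡ col λp c′ → row λp c < row λp c′ →
      toℕ (Inverse.to filling c) < toℕ (Inverse.to filling c′)
open SYT public

-- Row (index) containing entry m (0 if m is out of range; never used then).
rowOfEntry : ∀ {n} {λp : Partition n} → SYT λp → ℕ → ℕ
rowOfEntry {n} {λp} T m with m <? n
... | yes p = row λp (Inverse.from (filling T) (fromℕ< p))
... | no _  = 0

-- m is a descent of T if m+1 is an entry and lies in a strictly lower row than m.
-- (With 0-indexed entries, descent m here corresponds to descent m+1 of the
-- usual 1-indexed tableau; the number of descents is the same.)
IsDescent : ∀ {n} {λp : Partition n} → SYT λp → ℕ → Set
IsDescent {n} T m = suc m < n × rowOfEntry T m < rowOfEntry T (suc m)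

isDescent? : ∀ {n} {λp : Partition n} (T : SYT λp) (m : ℕ) → Dec (IsDescent T m)
isDescent? {n} T m = (suc m <? n) ×-dec (rowOfEntry T m <? rowOfEntry T (suc m))

des : ∀ {n} {λp : Partition n} → SYT λp → ℕ
des {n} T = length (filter (isDescent? T) (upTo n))

-- The coefficient of q^d in  Σ_{T ∈ SYT(λ)} q^{des T}  is nonzero
-- (i.e. some tableau has exactly d descents).
CoeffNonzero : ∀ {n} → Partition n → ℕ → Set
CoeffNonzero λp d = ∃[ T ] (des {λp = λp} T ≡ d)

NoInternalZeros : (ℕ → Set) → Set
NoInternalZeros nz = ∀ i j k → i < j → j < k → nz i → nz k → nz j

module Submission where

-- If e_k starts row k ≥ 1, every smaller entry lies in a row above
-- k, so e_k − 1 is a descent: des T ≥ λ'₁ − 1.  If f_j is the j-th entry of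
-- row 0 (j ≥ 1), f_j − 1 is not a descent, nor is the largest entry, so at
-- most (n − 1) − (λ₁ − 1) positions are descents.
--
-- A Yamanouchi (lattice) word w of content λ yields the tableau
-- with entry m in row w[m]; its descents are the ascents of w.  By induction
-- on n we build a word with any d ascents in the interval, either from a word
-- for λ minus its first row (prefix of λ₁ zeros, one new ascent) or from a word
-- for λ minus its first column (prefix 0,1,…,λ'₁−1, λ'₁ − 1 new ascents).

open import Defs
open import Data.Nat using (ℕ; zero; suc; _⊓_; _+_; _≤_; _<_; _≥_; z<s; _∸_; z≤n; s≤s; _<?_; _≤?_; pred;
  _≤′_; ≤′-refl; ≤′-step; >-nonZero)
open import Data.Nat.Properties
open import Data.Bool using (Bool; true; false; not; _∧_)
open import Data.Fin as F using (Fin; toℕ; fromℕ<)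
open import Data.Fin.Properties using (toℕ<n; toℕ-fromℕ<; fromℕ<-toℕ; toℕ-injective)
open import Data.List as L using (List; []; _∷_; length; lookup; upTo; filter; _++_; _∷ʳ_)
open import Data.List.Properties using (length-++; filter-++; upTo-∷ʳ; length-replicate; length-map; take-map; take-all; take-[])
open import Data.Nat.ListAction using (sum)
open import Data.List.Relation.Unary.All using (All; []; _∷_)
open import Data.List.Relation.Unary.Linked using (Linked; []; [-]; _∷_)
open import Data.Product using (Σ; _×_; _,_; proj₁; proj₂; ∃-syntax)
open import Function.Bundles using (_⇔_; _↔_; Inverse; mk⇔; mk↔ₛ′)
open import Relation.Nullary using (Dec; yes; no; ¬_; does)
open import Relation.Nullary.Decidable using (dec-true; dec-false)
open import Relation.Binary.PropositionalEquality
open import Data.Empty using (⊥-elim)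
open import Algebra.Properties.CommutativeSemigroup +-commutativeSemigroup using (interchange; x∙yz≈y∙xz)

b2n : Bool → ℕ
b2n true = 1
b2n false = 0

count : (ℕ → Bool) → ℕ → ℕ
count f zero = 0
count f (suc n) = count f n + b2n (f n)

module _ {P : ℕ → Set} (P? : (x : ℕ) → Dec (P x)) where
  length-filter-∷ʳ : ∀ xs x → length (filter P? (xs ∷ʳ x)) ≡ length (filter P? xs) + b2n (does (P? x))
  length-filter-∷ʳ xs x rewrite filter-++ P? xs (x ∷ []) | length-++ (filter P? xs) {filter P? (x ∷ [])}
    with does (P? x)
  ... | true = refl
  ... | false = refl

  length-filter-upTo : ∀ n → length (filter P? (upTo n)) ≡ count (λ m → does (P? m)) n
  length-filter-upTo zero = refl
  length-filter-upTo (suc n) = begin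
    length (filter P? (upTo (suc n)))               ≡⟨ cong (λ xs → length (filter P? xs)) (sym (upTo-∷ʳ n)) ⟩
    length (filter P? (upTo n ∷ʳ n))                ≡⟨ length-filter-∷ʳ (upTo n) n ⟩
    length (filter P? (upTo n)) + b2n (does (P? n)) ≡⟨ cong (_+ b2n (does (P? n))) (length-filter-upTo n) ⟩
    count (λ m → does (P? m)) (suc n)               ∎
    where open ≡-Reasoning

count-mono : ∀ f {m n} → m ≤ n → count f m ≤ count f n
count-mono f le = go (≤⇒≤′ le)
  where
  go : ∀ {m n} → m ≤′ n → count f m ≤ count f n
  go ≤′-refl = ≤-refl
  go (≤′-step {n} p) = ≤-trans (go p) (m≤m+n (count f n) _)

count-ext : ∀ f g n → (∀ m → m < n → f m ≡ g m) → count f n ≡ count g n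
count-ext f g zero h = refl
count-ext f g (suc n) h = cong₂ _+_ (count-ext f g n (λ m p → h m (m≤n⇒m≤1+n p))) (cong b2n (h n ≤-refl))

b2n-not : ∀ b → b2n b + b2n (not b) ≡ 1
b2n-not true = refl
b2n-not false = refl

count-complement : ∀ f n → count f n + count (λ m → not (f m)) n ≡ n
count-complement f zero = refl
count-complement f (suc n) = begin
    (count f n + b2n (f n)) + (count f′ n + b2n (not (f n))) ≡⟨ interchange (count f n) _ _ _ ⟩
    (count f n + count f′ n) + (b2n (f n) + b2n (not (f n))) ≡⟨ cong₂ _+_ (count-complement f n) (b2n-not (f n)) ⟩
    n + 1                                                    ≡⟨ +-comm n 1 ⟩
    suc n                                                    ∎
  where
  open ≡-Reasoning
  f′ : ℕ → Bool
  f′ m = not (f m)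

count-chain : ∀ f N K (g : (i : ℕ) → .(i ≤ K) → ℕ) →
  (∀ i → .(p : i < K) → g i (<⇒≤ p) < g (suc i) p) →
  (∀ i → .(p : i ≤ K) → f (g i p) ≡ true) →
  g K ≤-refl < N → suc K ≤ count f N
count-chain f N K g inc pass gK<N = ≤-trans (chain K g inc pass) (count-mono f gK<N)
  where
  chain : ∀ K (g : (i : ℕ) → .(i ≤ K) → ℕ) →
    (∀ i → .(p : i < K) → g i (<⇒≤ p) < g (suc i) p) →
    (∀ i → .(p : i ≤ K) → f (g i p) ≡ true) →
    suc K ≤ count f (suc (g K ≤-refl))
  chain zero g inc pass rewrite pass 0 z≤n = m≤n+m 1 (count f (g 0 z≤n))
  chain (suc K) g inc pass rewrite pass (suc K) ≤-refl =
    subst (suc (suc K) ≤_) (+-comm 1 (count f (g (suc K) ≤-refl)))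
      (s≤s (≤-trans (chain K (λ i p → g i (m≤n⇒m≤1+n p)) (λ i p → inc i (m≤n⇒m≤1+n p))
                                (λ i p → pass i (m≤n⇒m≤1+n p)))
                    (count-mono f (inc K ≤-refl))))

cell-≡ : ∀ {r} {f : Fin r → ℕ} {c c′ : Σ (Fin r) (λ i → Fin (f i))} →
  toℕ (proj₁ c) ≡ toℕ (proj₁ c′) → toℕ (proj₂ c) ≡ toℕ (proj₂ c′) → c ≡ c′
cell-≡ {c = i , j} {i′ , j′} p q with toℕ-injective p
... | refl = cong (i ,_) (toℕ-injective q)

lookup-positive : ∀ {xs : List ℕ} → All (λ p → 1 ≤ p) xs → (i : Fin (length xs)) → 1 ≤ lookup xs i
lookup-positive (px ∷ _) F.zero = px
lookup-positive (_ ∷ pxs) (F.suc i) = lookup-positive pxs i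

suc-pred-pos : ∀ {x} → 0 < x → suc (pred x) ≡ x
suc-pred-pos p = suc-pred _ {{>-nonZero p}}

head0 : List ℕ → ℕ
head0 [] = 0
head0 (p ∷ _) = p

firstRow≡head0 : ∀ {n} (λp : Partition n) → firstRow λp ≡ head0 (parts λp)
firstRow≡head0 λp with parts λp
... | [] = refl
... | p ∷ _ = refl

lookup-first≡head0 : ∀ (xs : List ℕ) .(p : 0 < length xs) → lookup xs (fromℕ< p) ≡ head0 xs
lookup-first≡head0 (x ∷ xs) p = refl

module _ {n : ℕ} {λp : Partition n} (T : SYT λp) where
  entry : Cell λp → ℕ
  entry c = toℕ (Inverse.to (filling T) c)

  cellOf : ∀ m → m < n → Cell λp
  cellOf m p = Inverse.from (filling T) (fromℕ< p)

  rowOfEntry-cellOf : ∀ m (p : m < n) → rowOfEntry T m ≡ row λp (cellOf m p)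
  rowOfEntry-cellOf m p with m <? n
  ... | yes q = refl
  ... | no ¬q = ⊥-elim (¬q p)

  entry-cellOf : ∀ m (p : m < n) → entry (cellOf m p) ≡ m
  entry-cellOf m p = trans (cong toℕ (Inverse.strictlyInverseˡ (filling T) (fromℕ< p))) (toℕ-fromℕ< p)

  rowOfEntry-entry : ∀ c → rowOfEntry T (entry c) ≡ row λp c
  rowOfEntry-entry c = trans (rowOfEntry-cellOf (entry c) (toℕ<n to-c))
    (cong (row λp) (trans (cong (Inverse.from (filling T)) (fromℕ<-toℕ to-c (toℕ<n to-c)))
                          (Inverse.strictlyInverseʳ (filling T) c)))
    where to-c = Inverse.to (filling T) c

  descentAt : ℕ → Bool
  descentAt m = does (isDescent? T m)

  des≡count : des T ≡ count descentAt n
  des≡count = length-filter-upTo (isDescent? T) n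

-- Lower bound: the entry e_k starting row k ≥ 1 is preceded by a descent,
-- because all entries below e_k lie in rows above k.

module FirstColumn {n : ℕ} {λp : Partition n} (T : SYT λp) where
  r = numRows λp

  firstColumnCell : ∀ k → .(k < r) → Cell λp
  firstColumnCell k p = fromℕ< p , fromℕ< (lookup-positive (positive λp) (fromℕ< p))

  e : ∀ k → .(k < r) → ℕ
  e k p = entry T (firstColumnCell k p)

  e-< : ∀ k k′ .(p : k < r) .(p′ : k′ < r) → k < k′ → e k p < e k′ p′
  e-< k k′ p p′ lt = colIncreasing T (firstColumnCell k p) (firstColumnCell k′ p′)
    (trans (toℕ-fromℕ< _) (sym (toℕ-fromℕ< _)))
    (subst₂ _<_ (sym (toℕ-fromℕ< p)) (sym (toℕ-fromℕ< p′)) lt)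

  e-≤ : ∀ k k′ .(p : k < r) .(p′ : k′ < r) → k ≤ k′ → e k p ≤ e k′ p′
  e-≤ k k′ p p′ le with k ≟ k′
  ... | yes refl = ≤-refl
  ... | no ne = <⇒≤ (e-< k k′ p p′ (≤∧≢⇒< le ne))

  e-pos : ∀ k .(p : k < r) → 0 < k → 0 < e k p
  e-pos k p kp = ≤-<-trans z≤n (e-< 0 k (<-trans kp p) p kp)

  e-least : ∀ k .(p : k < r) c → k ≤ row λp c → e k p ≤ entry T c
  e-least k p c le = ≤-trans (e-≤ k i p (toℕ<n (proj₁ c)) le) start≤c
    where
    i = row λp c
    start≤c : e i (toℕ<n (proj₁ c)) ≤ entry T c
    start≤c with col λp c ≟ 0
    ... | yes c0 = ≤-reflexive (cong (entry T) (cell-≡ (toℕ-fromℕ< _) (trans (toℕ-fromℕ< _) (sym c0))))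
    ... | no c0 = <⇒≤ (rowIncreasing T (firstColumnCell i (toℕ<n (proj₁ c))) c (toℕ-fromℕ< _)
                        (subst (_< col λp c) (sym (toℕ-fromℕ< _)) (n≢0⇒n>0 c0)))

  descent-before : ∀ k .(p : k < r) → 0 < k → IsDescent T (pred (e k p))
  descent-before k p kp = sm<n , subst₂ _<_ (sym (rowOfEntry-cellOf T m m<n)) (sym row-sm) row-m<k
    where
    m = pred (e k p)
    sm : suc m ≡ e k p
    sm = suc-pred-pos (e-pos k p kp)
    sm<n : suc m < n
    sm<n = subst (_< n) (sym sm) (toℕ<n (Inverse.to (filling T) (firstColumnCell k p)))
    m<n : m < n
    m<n = <-trans (n<1+n m) sm<n
    row-sm : rowOfEntry T (suc m) ≡ k
    row-sm = trans (cong (rowOfEntry T) sm) (trans (rowOfEntry-entry T (firstColumnCell k p)) (toℕ-fromℕ< p))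
    row-m<k : row λp (cellOf T m m<n) < k
    row-m<k with k ≤? row λp (cellOf T m m<n)
    ... | no k≰ = ≰⇒> k≰
    ... | yes k≤ = ⊥-elim (<⇒≱ (subst (_< e k p) (sym (entry-cellOf T m m<n)) (subst (m <_) sm (n<1+n m)))
                                  (e-least k p (cellOf T m m<n) k≤))

  des-lower-bound : r ∸ 1 ≤ des T
  des-lower-bound with r in eq
  ... | zero = z≤n
  ... | suc zero = z≤n
  ... | suc (suc K) = subst (suc K ≤_) (sym (des≡count T)) (count-chain (descentAt T) n K g inc pass last<n)
    where
    -- g i = e_{i+1} − 1, for the rows 1, …, K + 1 = r − 1.
    q : ∀ i → (i ≤ K) → suc i < r
    q i p = subst (suc i <_) (sym eq) (s≤s (s≤s p))
    g : (i : ℕ) → .(i ≤ K) → ℕ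
    g i p = pred (e (suc i) (q i p))
    inc : ∀ i → .(p : i < K) → g i (<⇒≤ p) < g (suc i) p
    inc i p = pred-mono-< {{>-nonZero (e-pos (suc i) _ z<s)}} (e-< (suc i) (suc (suc i)) _ _ ≤-refl)
    pass : ∀ i → .(p : i ≤ K) → descentAt T (g i p) ≡ true
    pass i p = dec-true (isDescent? T (g i p)) (descent-before (suc i) (q i p) z<s)
    last<n : g K ≤-refl < n
    last<n = <-trans (n<1+n _) (proj₁ (descent-before (suc K) (q K ≤-refl) z<s))

numRows-pos : ∀ {n} (λp : Partition (suc n)) → 0 < numRows λp
numRows-pos λp = nonempty (parts λp) (subst (0 <_) (sym (sums λp)) z<s)
  where
  nonempty : ∀ xs → 0 < sum xs → 0 < length xs
  nonempty (x ∷ xs) _ = z<s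

-- Upper bound: an entry f_j of the first row (j ≥ 1) is not preceded by a
-- descent, and the largest entry is not a descent either.

module FirstRow {n′ : ℕ} {λp : Partition (suc n′)} (T : SYT λp) where
  r>0 = numRows-pos λp
  λ₁ = lookup (parts λp) (fromℕ< r>0)

  firstRowCell : ∀ j → .(j < λ₁) → Cell λp
  firstRowCell j p = fromℕ< r>0 , fromℕ< p

  f : ∀ j → .(j < λ₁) → ℕ
  f j p = entry T (firstRowCell j p)

  f-< : ∀ j j′ .(p : j < λ₁) .(p′ : j′ < λ₁) → j < j′ → f j p < f j′ p′
  f-< j j′ p p′ lt = rowIncreasing T (firstRowCell j p) (firstRowCell j′ p′) refl
    (subst₂ _<_ (sym (toℕ-fromℕ< p)) (sym (toℕ-fromℕ< p′)) lt)

  f-pos : ∀ j .(p : j < λ₁) → 0 < j → 0 < f j p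
  f-pos j p jp = ≤-<-trans z≤n (f-< 0 j (<-trans jp p) p jp)

  no-descent-before : ∀ j .(p : j < λ₁) → 0 < j → ¬ IsDescent T (pred (f j p))
  no-descent-before j p jp (_ , lt) = n≮0 (subst (rowOfEntry T (pred (f j p)) <_) row-f lt)
    where
    row-f : rowOfEntry T (suc (pred (f j p))) ≡ 0
    row-f = trans (cong (rowOfEntry T) (suc-pred-pos (f-pos j p jp)))
                  (trans (rowOfEntry-entry T (firstRowCell j p)) (toℕ-fromℕ< r>0))

  nonDescentAt : ℕ → Bool
  nonDescentAt m = not (descentAt T m)

  -- The largest entry n′ is not a descent, so only positions below n′ count.
  des≡count-below-last : des T ≡ count (descentAt T) n′
  des≡count-below-last = begin
    des T                                               ≡⟨ des≡count T ⟩
    count (descentAt T) n′ + b2n (descentAt T n′)       ≡⟨ cong (λ b → count (descentAt T) n′ + b2n b) last ⟩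
    count (descentAt T) n′ + 0                          ≡⟨ +-identityʳ _ ⟩
    count (descentAt T) n′                              ∎
    where
    open ≡-Reasoning
    last : descentAt T n′ ≡ false
    last = dec-false (isDescent? T n′) (λ (lt , _) → <-irrefl refl lt)

  non-descents : λ₁ ∸ 1 ≤ count nonDescentAt n′
  non-descents with λ₁ in eq
  ... | zero = z≤n
  ... | suc zero = z≤n
  ... | suc (suc K) = count-chain nonDescentAt n′ K g inc pass last<n′
    where
    -- g i = f_{i+1} − 1, for the columns 1, …, K + 1 = λ₁ − 1.
    q : ∀ i → (i ≤ K) → suc i < λ₁
    q i p = subst (suc i <_) (sym eq) (s≤s (s≤s p))
    g : (i : ℕ) → .(i ≤ K) → ℕ
    g i p = pred (f (suc i) (q i p))
    inc : ∀ i → .(p : i < K) → g i (<⇒≤ p) < g (suc i) p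
    inc i p = pred-mono-< {{>-nonZero (f-pos (suc i) _ z<s)}} (f-< (suc i) (suc (suc i)) _ _ ≤-refl)
    pass : ∀ i → .(p : i ≤ K) → nonDescentAt (g i p) ≡ true
    pass i p = cong not (dec-false (isDescent? T (g i p)) (no-descent-before (suc i) (q i p) z<s))
    last<n′ : g K ≤-refl < n′
    last<n′ = ≤-pred (subst (_< suc n′) (sym (suc-pred-pos (f-pos (suc K) (q K ≤-refl) z<s)))
                       (toℕ<n (Inverse.to (filling T) (firstRowCell (suc K) _))))

  des-upper-bound : des T ≤ suc n′ ∸ λ₁
  des-upper-bound with λ₁ | lookup-positive (positive λp) (fromℕ< r>0) | non-descents
  ... | suc l | s≤s z≤n | nd = m+n≤o⇒m≤o∸n (des T) (begin
    des T + l                                          ≡⟨ cong (_+ l) des≡count-below-last ⟩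
    count (descentAt T) n′ + l                         ≤⟨ +-monoʳ-≤ (count (descentAt T) n′) nd ⟩
    count (descentAt T) n′ + count nonDescentAt n′     ≡⟨ count-complement (descentAt T) n′ ⟩
    n′                                                 ∎)
    where open ≤-Reasoning

-- A word is a list of row indices; `at w m` is its m-th letter (0 past
-- the end), `occ i w` the number of letters i, `occBefore i k w` the number of
-- letters i among the first k, and `position i j w` the position of the j-th
-- letter i (counting from 0).  Equality of letters is decided structurally,
-- so that `with` abstracts it in goals.

_≟′_ : (a b : ℕ) → Dec (a ≡ b)
zero ≟′ zero = yes refl
zero ≟′ suc b = no λ ()
suc a ≟′ zero = no λ ()
suc a ≟′ suc b with a ≟′ b
... | yes refl = yes refl
... | no ne = no (λ eq → ne (suc-injective eq))

at : List ℕ → ℕ → ℕ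
at [] _ = 0
at (x ∷ xs) zero = x
at (x ∷ xs) (suc m) = at xs m

δ : ℕ → ℕ → ℕ
δ x i = b2n (does (x ≟′ i))

occ : ℕ → List ℕ → ℕ
occ i [] = 0
occ i (x ∷ xs) = δ x i + occ i xs

occBefore : ℕ → ℕ → List ℕ → ℕ
occBefore i k w = occ i (L.take k w)

position : ℕ → ℕ → List ℕ → ℕ
position i j [] = 0
position i j (x ∷ xs) with x ≟′ i
position i zero (x ∷ xs) | yes _ = 0
position i (suc j) (x ∷ xs) | yes _ = suc (position i j xs)
... | no _ = suc (position i j xs)

δ-refl : ∀ x → δ x x ≡ 1
δ-refl x with x ≟′ x
... | yes _ = refl
... | no ne = ⊥-elim (ne refl)

δ-no : ∀ {x i} → ¬ x ≡ i → δ x i ≡ 0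
δ-no {x} {i} ne with x ≟′ i
... | yes eq = ⊥-elim (ne eq)
... | no _ = refl

lookup≡at : ∀ (xs : List ℕ) (i : Fin (length xs)) → lookup xs i ≡ at xs (toℕ i)
lookup≡at (x ∷ xs) F.zero = refl
lookup≡at (x ∷ xs) (F.suc i) = lookup≡at xs i

at-beyond : ∀ xs i → length xs ≤ i → at xs i ≡ 0
at-beyond [] i _ = refl
at-beyond (x ∷ xs) (suc i) (s≤s le) = at-beyond xs i le

occBefore≤occ : ∀ i k xs → occBefore i k xs ≤ occ i xs
occBefore≤occ i zero xs = z≤n
occBefore≤occ i (suc k) [] = z≤n
occBefore≤occ i (suc k) (x ∷ xs) = +-monoʳ-≤ (δ x i) (occBefore≤occ i k xs)

position<length : ∀ i j xs → j < occ i xs → position i j xs < length xs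
position<length i j (x ∷ xs) lt with x ≟′ i
position<length i zero (x ∷ xs) lt | yes _ = z<s
position<length i (suc j) (x ∷ xs) (s≤s lt) | yes _ = s≤s (position<length i j xs lt)
... | no _ = s≤s (position<length i j xs lt)

at-position : ∀ i j xs → j < occ i xs → at xs (position i j xs) ≡ i
at-position i j (x ∷ xs) lt with x ≟′ i
at-position i zero (x ∷ xs) lt | yes eq = eq
at-position i (suc j) (x ∷ xs) (s≤s lt) | yes _ = at-position i j xs lt
... | no _ = at-position i j xs lt

occBefore-position : ∀ i j xs → j < occ i xs → occBefore i (position i j xs) xs ≡ j
occBefore-position i j (x ∷ xs) lt with x ≟′ i
occBefore-position i zero (x ∷ xs) lt | yes eq = refl
occBefore-position i (suc j) (x ∷ xs) (s≤s lt) | yes refl rewrite δ-refl x = cong suc (occBefore-position i j xs lt)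
... | no ne rewrite δ-no ne = occBefore-position i j xs lt

occBefore-suc-position : ∀ i j xs → j < occ i xs → occBefore i (suc (position i j xs)) xs ≡ suc j
occBefore-suc-position i j (x ∷ xs) lt with x ≟′ i
occBefore-suc-position i zero (x ∷ xs) lt | yes eq = refl
occBefore-suc-position i (suc j) (x ∷ xs) (s≤s lt) | yes _ = cong suc (occBefore-suc-position i j xs lt)
... | no _ = occBefore-suc-position i j xs lt

position-occBefore : ∀ m xs → m < length xs → position (at xs m) (occBefore (at xs m) m xs) xs ≡ m
position-occBefore zero (x ∷ xs) lt with x ≟′ x
... | yes _ = refl
... | no ne = ⊥-elim (ne refl)
position-occBefore (suc m) (x ∷ xs) (s≤s lt) with x ≟′ at xs m
... | yes _ = cong suc (position-occBefore m xs lt)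
... | no _ = cong suc (position-occBefore m xs lt)

occBefore<occ : ∀ m xs → m < length xs → occBefore (at xs m) m xs < occ (at xs m) xs
occBefore<occ zero (x ∷ xs) lt = subst (0 <_) (sym (cong (_+ occ x xs) (δ-refl x))) z<s
occBefore<occ (suc m) (x ∷ xs) (s≤s lt) = +-monoʳ-< (δ x (at xs m)) (occBefore<occ m xs lt)

position-< : ∀ i j j′ xs → j < j′ → j′ < occ i xs → position i j xs < position i j′ xs
position-< i j j′ (x ∷ xs) jj lt with x ≟′ i
position-< i zero (suc j′) (x ∷ xs) jj lt | yes _ = z<s
position-< i (suc j) (suc j′) (x ∷ xs) (s≤s jj) (s≤s lt) | yes _ = s≤s (position-< i j j′ xs jj lt)
... | no _ = s≤s (position-< i j j′ xs jj lt)

position<bound : ∀ i j k xs → j < occBefore i k xs → position i j xs < k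
position<bound i j (suc k) (x ∷ xs) lt with x ≟′ i
position<bound i zero (suc k) (x ∷ xs) lt | yes _ = z<s
position<bound i (suc j) (suc k) (x ∷ xs) (s≤s lt) | yes _ = s≤s (position<bound i j k xs lt)
... | no _ = s≤s (position<bound i j k xs lt)

Lattice : List ℕ → Set
Lattice w = ∀ k i i′ → i < i′ → occBefore i′ k w ≤ occBefore i k w

-- In a lattice word the J-th letter i comes before the J-th letter i′ > i:
-- this is what makes columns of the associated tableau increase.
lattice-column : ∀ w → Lattice w → ∀ i i′ J → i < i′ → J < occ i′ w → position i J w < position i′ J w
lattice-column w lat i i′ J i<i′ J<occ = ≤∧≢⇒< (≤-pred (position<bound i J (suc m) w enough)) distinct
  where
  m = position i′ J w
  enough : suc J ≤ occBefore i (suc m) w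
  enough = subst (_≤ occBefore i (suc m) w) (occBefore-suc-position i′ J w J<occ) (lat (suc m) i i′ i<i′)
  distinct : position i J w ≢ m
  distinct eq = <-irrefl (trans (sym (at-position i J w (≤-trans enough (occBefore≤occ i (suc m) w))))
                                (trans (cong (at w) eq) (at-position i′ J w J<occ))) i<i′

ascents : List ℕ → ℕ
ascents [] = 0
ascents (x ∷ []) = 0
ascents (x ∷ y ∷ ys) = b2n (does (x <? y)) + ascents (y ∷ ys)

ascentAt : ℕ → List ℕ → ℕ → Bool
ascentAt N w m = does (suc m <? N) ∧ does (at w m <? at w (suc m))

count-shift : ∀ f n → count f (suc n) ≡ b2n (f 0) + count (λ m → f (suc m)) n
count-shift f zero = +-comm 0 (b2n (f 0))
count-shift f (suc n) = trans (cong (_+ b2n (f (suc n))) (count-shift f n))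
  (+-assoc (b2n (f 0)) (count (λ m → f (suc m)) n) (b2n (f (suc n))))

ascents≡count : ∀ w → ascents w ≡ count (ascentAt (length w) w) (length w)
ascents≡count [] = refl
ascents≡count (x ∷ []) = refl
ascents≡count (x ∷ y ∷ ys) = trans (cong (b2n (does (x <? y)) +_) (ascents≡count (y ∷ ys)))
  (sym (count-shift (ascentAt (length (x ∷ y ∷ ys)) (x ∷ y ∷ ys)) (length (y ∷ ys))))

-- The tableau of a lattice word w of content λ: the j-th letter i of w is the
-- entry in cell (i, j).  Rows increase because positions of letters i do,
-- columns by `lattice-column`; entry m lies in row `at w m`, so the descents
-- of the tableau are the ascents of w.

module WordTableau {n} (λp : Partition n) (w : List ℕ) (len : length w ≡ n)
  (content : ∀ i → occ i w ≡ at (parts λp) i) (lat : Lattice w) where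
  private
    ps = parts λp
    r = length ps

    col<occ : ∀ (c : Cell λp) → col λp c < occ (row λp c) w
    col<occ (i , j) = subst (toℕ j <_) (sym (trans (content (toℕ i)) (sym (lookup≡at ps i)))) (toℕ<n j)

    positionOf : Cell λp → ℕ
    positionOf c = position (row λp c) (col λp c) w

    toF : Cell λp → Fin n
    toF c = fromℕ< (subst (positionOf c <_) len (position<length _ _ w (col<occ c)))

    m<length : (m : Fin n) → toℕ m < length w
    m<length m = subst (toℕ m <_) (sym len) (toℕ<n m)

    letter : Fin n → ℕ
    letter m = at w (toℕ m)

    rank : Fin n → ℕ
    rank m = occBefore (letter m) (toℕ m) w

    rank<occ : (m : Fin n) → rank m < occ (letter m) w
    rank<occ m = occBefore<occ (toℕ m) w (m<length m)

    letter<r : (m : Fin n) → letter m < r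
    letter<r m with letter m <? r
    ... | yes p = p
    ... | no np = ⊥-elim (n≮0 (subst (rank m <_) (trans (content (letter m)) (at-beyond ps (letter m) (≮⇒≥ np))) (rank<occ m)))

    rank<rowLength : (m : Fin n) → rank m < lookup ps (fromℕ< (letter<r m))
    rank<rowLength m = subst (rank m <_)
      (trans (content (letter m)) (trans (cong (at ps) (sym (toℕ-fromℕ< (letter<r m)))) (sym (lookup≡at ps _))))
      (rank<occ m)

    fromF : Fin n → Cell λp
    fromF m = fromℕ< (letter<r m) , fromℕ< (rank<rowLength m)

    toF-fromF : ∀ m → toF (fromF m) ≡ m
    toF-fromF m = toℕ-injective (trans (toℕ-fromℕ< _)
      (trans (cong₂ (λ a b → position a b w) (toℕ-fromℕ< (letter<r m)) (toℕ-fromℕ< (rank<rowLength m)))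
             (position-occBefore (toℕ m) w (m<length m))))

    fromF-toF : ∀ c → fromF (toF c) ≡ c
    fromF-toF c = cell-≡ (trans (toℕ-fromℕ< _) (trans (cong (at w) (toℕ-fromℕ< _)) (at-position _ _ w (col<occ c))))
      (trans (toℕ-fromℕ< _) (begin
        occBefore (at w (toℕ (toF c))) (toℕ (toF c)) w ≡⟨ cong (λ z → occBefore (at w z) z w) {toℕ (toF c)} {positionOf c} (toℕ-fromℕ< _) ⟩
        occBefore (at w (positionOf c)) (positionOf c) w ≡⟨ cong (λ a → occBefore a (positionOf c) w) (at-position _ _ w (col<occ c)) ⟩
        occBefore (row λp c) (positionOf c) w           ≡⟨ occBefore-position _ _ w (col<occ c) ⟩
        col λp c                                        ∎))
      where open ≡-Reasoning

    filling′ : Cell λp ↔ Fin n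
    filling′ = mk↔ₛ′ toF fromF toF-fromF fromF-toF

    rows-increase : ∀ (c c′ : Cell λp) → row λp c ≡ row λp c′ → col λp c < col λp c′ →
      toℕ (toF c) < toℕ (toF c′)
    rows-increase c c′ same lt = subst₂ _<_ (sym (toℕ-fromℕ< _)) (sym (toℕ-fromℕ< _))
      (subst (λ i → position i (col λp c) w < positionOf c′) (sym same) (position-< _ _ _ w lt (col<occ c′)))

    columns-increase : ∀ (c c′ : Cell λp) → col λp c ≡ col λp c′ → row λp c < row λp c′ →
      toℕ (toF c) < toℕ (toF c′)
    columns-increase c c′ same lt = subst₂ _<_ (sym (toℕ-fromℕ< _)) (sym (toℕ-fromℕ< _))
      (subst (λ j → position (row λp c) j w < positionOf c′) (sym same) (lattice-column w lat _ _ _ lt (col<occ c′)))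

  tableau : SYT λp
  tableau = mkSYT filling′ rows-increase columns-increase

  rowOfEntry-tableau : ∀ m → m < n → rowOfEntry tableau m ≡ at w m
  rowOfEntry-tableau m p = trans (rowOfEntry-cellOf tableau m p) (trans (toℕ-fromℕ< _) (cong (at w) (toℕ-fromℕ< p)))

  des-tableau : des tableau ≡ ascents w
  des-tableau = begin
    des tableau                        ≡⟨ des≡count tableau ⟩
    count (descentAt tableau) n        ≡⟨ count-ext _ _ n descent≡ascent ⟩
    count (ascentAt n w) n             ≡⟨ cong (λ N → count (ascentAt N w) N) (sym len) ⟩
    count (ascentAt (length w) w) (length w) ≡⟨ sym (ascents≡count w) ⟩
    ascents w                          ∎
    where
    open ≡-Reasoning
    -- Both sides are `does (suc m <? n) ∧ …`; they agree when suc m < n.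
    ∧-congˡ : ∀ {A : Set} (a? : Dec A) {u v : Bool} → (A → u ≡ v) → does a? ∧ u ≡ does a? ∧ v
    ∧-congˡ (yes a) h = h a
    ∧-congˡ (no _) h = refl
    descent≡ascent : ∀ m → m < n → descentAt tableau m ≡ ascentAt n w m
    descent≡ascent m m<n = ∧-congˡ (suc m <? n)
      (λ p → cong₂ (λ a b → does (a <? b)) (rowOfEntry-tableau m m<n) (rowOfEntry-tableau (suc m) p))

Positive : List ℕ → Set
Positive = All (λ p → 1 ≤ p)

Decreasing : List ℕ → Set
Decreasing = Linked _≥_

Decreasing-tail : ∀ {x xs} → Decreasing (x ∷ xs) → Decreasing xs
Decreasing-tail [-] = []
Decreasing-tail (_ ∷ l) = l

dropColumn : List ℕ → List ℕ
dropColumn [] = []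
dropColumn (zero ∷ xs) = []
dropColumn (suc zero ∷ xs) = []
dropColumn (suc (suc k) ∷ xs) = suc k ∷ dropColumn xs

dropColumn-positive : ∀ ps → Positive (dropColumn ps)
dropColumn-positive [] = []
dropColumn-positive (zero ∷ xs) = []
dropColumn-positive (suc zero ∷ xs) = []
dropColumn-positive (suc (suc k) ∷ xs) = s≤s z≤n ∷ dropColumn-positive xs

dropColumn-decreasing : ∀ ps → Decreasing ps → Decreasing (dropColumn ps)
dropColumn-decreasing [] l = []
dropColumn-decreasing (zero ∷ xs) l = []
dropColumn-decreasing (suc zero ∷ xs) l = []
dropColumn-decreasing (suc (suc k) ∷ []) l = [-]
dropColumn-decreasing (suc (suc k) ∷ zero ∷ xs) l = [-]
dropColumn-decreasing (suc (suc k) ∷ suc zero ∷ xs) l = [-]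
dropColumn-decreasing (suc (suc k) ∷ suc (suc m) ∷ xs) (s≤s le ∷ l) = le ∷ dropColumn-decreasing (suc (suc m) ∷ xs) l

at-column : ∀ xs → Positive xs → Decreasing (1 ∷ xs) → ∀ i → at (1 ∷ xs) i ≡ b2n (does (i <? length (1 ∷ xs)))
at-column xs px l zero = refl
at-column [] px l (suc i) = refl
at-column (suc zero ∷ ys) (_ ∷ py) l (suc i) = at-column ys py (Decreasing-tail l) i
at-column (suc (suc y) ∷ ys) px (s≤s () ∷ l) (suc i)

sum-column : ∀ xs → Positive xs → Decreasing (1 ∷ xs) → sum xs ≡ length xs
sum-column [] px l = refl
sum-column (suc zero ∷ ys) (_ ∷ py) l = cong suc (sum-column ys py (Decreasing-tail l))
sum-column (suc (suc y) ∷ ys) px (s≤s () ∷ l)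

at-dropColumn : ∀ ps → Positive ps → Decreasing ps → ∀ i → at ps i ≡ b2n (does (i <? length ps)) + at (dropColumn ps) i
at-dropColumn [] px l i = refl
at-dropColumn (suc zero ∷ xs) (_ ∷ px) l i = trans (at-column xs px l i) (sym (+-identityʳ _))
at-dropColumn (suc (suc k) ∷ xs) px l zero = refl
at-dropColumn (suc (suc k) ∷ xs) (_ ∷ px) l (suc i) = at-dropColumn xs px (Decreasing-tail l) i

length+sum-dropColumn : ∀ ps → Positive ps → Decreasing ps → length ps + sum (dropColumn ps) ≡ sum ps
length+sum-dropColumn [] px l = refl
length+sum-dropColumn (suc zero ∷ xs) (_ ∷ px) l = cong suc (trans (+-identityʳ _) (sym (sum-column xs px l)))
length+sum-dropColumn (suc (suc k) ∷ xs) (_ ∷ px) l = cong suc (begin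
    length xs + suc (k + sum (dropColumn xs))   ≡⟨ +-suc (length xs) _ ⟩
    suc (length xs + (k + sum (dropColumn xs))) ≡⟨ cong suc (x∙yz≈y∙xz (length xs) k _) ⟩
    suc (k + (length xs + sum (dropColumn xs))) ≡⟨ cong (λ z → suc (k + z)) (length+sum-dropColumn xs px (Decreasing-tail l)) ⟩
    suc (k + sum xs)                            ∎)
  where open ≡-Reasoning

length-dropColumn≤ : ∀ ps → length (dropColumn ps) ≤ length ps
length-dropColumn≤ [] = z≤n
length-dropColumn≤ (zero ∷ xs) = z≤n
length-dropColumn≤ (suc zero ∷ xs) = z≤n
length-dropColumn≤ (suc (suc k) ∷ xs) = s≤s (length-dropColumn≤ xs)

length-dropColumn-∷ : ∀ x xs → length (dropColumn (x ∷ xs)) ≤ suc (length (dropColumn xs))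
length-dropColumn-∷ zero xs = z≤n
length-dropColumn-∷ (suc zero) xs = z≤n
length-dropColumn-∷ (suc (suc k)) xs = ≤-refl

length≤sum : ∀ xs → Positive xs → length xs ≤ sum xs
length≤sum [] _ = z≤n
length≤sum (x ∷ xs) (px ∷ pxs) = +-mono-≤ px (length≤sum xs pxs)

length+length-dropColumn≤sum : ∀ xs → Positive xs → length xs + length (dropColumn xs) ≤ sum xs
length+length-dropColumn≤sum [] _ = z≤n
length+length-dropColumn≤sum (suc zero ∷ xs) (_ ∷ px) = s≤s (subst (_≤ sum xs) (sym (+-identityʳ _)) (length≤sum xs px))
length+length-dropColumn≤sum (suc (suc k) ∷ xs) (_ ∷ px) = s≤s (subst (_≤ suc (k + sum xs)) (sym (+-suc (length xs) _))
  (s≤s (≤-trans (length+length-dropColumn≤sum xs px) (m≤n+m (sum xs) k))))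

at≤head0 : ∀ xs → Decreasing xs → ∀ j → at xs j ≤ head0 xs
at≤head0 [] l j = z≤n
at≤head0 (x ∷ xs) l zero = ≤-refl
at≤head0 (x ∷ []) l (suc j) = z≤n
at≤head0 (x ∷ y ∷ ys) (le ∷ l) (suc j) = ≤-trans (at≤head0 (y ∷ ys) l j) le

occ-++ : ∀ i xs ys → occ i (xs ++ ys) ≡ occ i xs + occ i ys
occ-++ i [] ys = refl
occ-++ i (x ∷ xs) ys = trans (cong (δ x i +_) (occ-++ i xs ys)) (sym (+-assoc (δ x i) _ _))

occBefore-++ : ∀ i k xs ys → occBefore i k (xs ++ ys) ≡ occBefore i k xs + occBefore i (k ∸ length xs) ys
occBefore-++ i k [] ys = cong (λ xs → occ i xs + occBefore i k ys) (sym (take-[] k))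
occBefore-++ i zero (x ∷ xs) ys = refl
occBefore-++ i (suc k) (x ∷ xs) ys = trans (cong (δ x i +_) (occBefore-++ i k xs ys)) (sym (+-assoc (δ x i) _ _))

occBefore-all : ∀ i k xs → length xs ≤ k → occBefore i k xs ≡ occ i xs
occBefore-all i k xs le = cong (occ i) (take-all k xs le)

δ-suc : ∀ x j → δ (suc x) (suc j) ≡ δ x j
δ-suc x j with x ≟′ j
... | yes refl = refl
... | no _ = refl

zeros : ℕ → List ℕ
zeros p = L.replicate p 0

occ-zeros : ∀ p → occ 0 (zeros p) ≡ p
occ-zeros zero = refl
occ-zeros (suc p) = cong suc (occ-zeros p)

occ-suc-zeros : ∀ j p → occ (suc j) (zeros p) ≡ 0
occ-suc-zeros j zero = refl
occ-suc-zeros j (suc p) = occ-suc-zeros j p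

occBefore-suc-zeros : ∀ j k p → occBefore (suc j) k (zeros p) ≡ 0
occBefore-suc-zeros j k p = n≤0⇒n≡0 (subst (occBefore (suc j) k (zeros p) ≤_) (occ-suc-zeros j p) (occBefore≤occ (suc j) k (zeros p)))

occ-map-suc : ∀ j w → occ (suc j) (L.map suc w) ≡ occ j w
occ-map-suc j [] = refl
occ-map-suc j (x ∷ w) = cong₂ _+_ (δ-suc x j) (occ-map-suc j w)

occ-zero-map-suc : ∀ w → occ 0 (L.map suc w) ≡ 0
occ-zero-map-suc [] = refl
occ-zero-map-suc (x ∷ w) = occ-zero-map-suc w

occBefore-map-suc : ∀ j k w → occBefore (suc j) k (L.map suc w) ≡ occBefore j k w
occBefore-map-suc j k w = trans (cong (occ (suc j)) (take-map k w)) (occ-map-suc j (L.take k w))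

occBefore-zero-map-suc : ∀ k w → occBefore 0 k (L.map suc w) ≡ 0
occBefore-zero-map-suc k w = trans (cong (occ 0) (take-map k w)) (occ-zero-map-suc (L.take k w))

range : ℕ → ℕ → List ℕ
range a zero = []
range a (suc r) = a ∷ range (suc a) r

length-range : ∀ a r → length (range a r) ≡ r
length-range a zero = refl
length-range a (suc r) = cong suc (length-range (suc a) r)

occBefore-range-below : ∀ i k a r → i < a → occBefore i k (range a r) ≡ 0
occBefore-range-below i zero a r lt = refl
occBefore-range-below i (suc k) a zero lt = refl
occBefore-range-below i (suc k) a (suc r) lt =
  cong₂ _+_ (δ-no (λ eq → <-irrefl (sym eq) lt)) (occBefore-range-below i k (suc a) r (m<n⇒m<1+n lt))

occBefore-range : ∀ a i k r → occBefore (a + i) k (range a r) ≡ b2n (does (i <? k ⊓ r))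
occBefore-range a i zero r = refl
occBefore-range a i (suc k) zero = refl
occBefore-range a zero (suc k) (suc r)
  rewrite +-identityʳ a | δ-refl a | occBefore-range-below a k (suc a) r ≤-refl = refl
occBefore-range a (suc i) (suc k) (suc r) =
  cong₂ _+_ (δ-no {a} {a + suc i} (λ eq → <-irrefl eq (subst (a <_) (sym (+-suc a i)) (s≤s (m≤m+n a i)))))
            (trans (cong (λ z → occBefore z k (range (suc a) r)) (+-suc a i)) (occBefore-range (suc a) i k r))

ascents-zeros : ∀ p → ascents (zeros p) ≡ 0
ascents-zeros zero = refl
ascents-zeros (suc zero) = refl
ascents-zeros (suc (suc p)) = ascents-zeros (suc p)

ascents-zeros-++ : ∀ p y ys → ascents (zeros (suc p) ++ suc y ∷ ys) ≡ suc (ascents (suc y ∷ ys))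
ascents-zeros-++ zero y ys = refl
ascents-zeros-++ (suc p) y ys = ascents-zeros-++ p y ys

ascents-map-suc : ∀ w → ascents (L.map suc w) ≡ ascents w
ascents-map-suc [] = refl
ascents-map-suc (x ∷ []) = refl
ascents-map-suc (x ∷ y ∷ ys) = cong (b2n (does (x <? y)) +_) (ascents-map-suc (y ∷ ys))

ascents-range-++ : ∀ a r ys → ascents (range a (suc r) ++ 0 ∷ ys) ≡ r + ascents (0 ∷ ys)
ascents-range-++ a zero ys = refl
ascents-range-++ a (suc r) ys = cong₂ _+_ (cong b2n (dec-true (a <? suc a) ≤-refl)) (ascents-range-++ (suc a) r ys)

record Yamanouchi (ps : List ℕ) (w : List ℕ) : Set where
  field
    length≡sum : length w ≡ sum ps
    content : ∀ i → occ i w ≡ at ps i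
    lattice : Lattice w
open Yamanouchi

-- A nonempty lattice word starts with 0: its first letter must not exceed 0.
lattice-head : ∀ x ys → Lattice (x ∷ ys) → x ≡ 0
lattice-head zero ys lat = refl
lattice-head (suc x) ys lat with subst (λ z → z + 0 ≤ 0) (δ-refl (suc x)) (lat 1 0 (suc x) z<s)
... | ()

yamanouchi-∷ : ∀ {ps w} → Yamanouchi ps w → 0 < sum ps → Σ (List ℕ) (λ ys → w ≡ 0 ∷ ys)
yamanouchi-∷ {w = []} y lt = ⊥-elim (<-irrefl (length≡sum y) lt)
yamanouchi-∷ {w = x ∷ ys} y lt = ys , cong (_∷ ys) (lattice-head x ys (lattice y))

yamanouchi-oneRow : ∀ p → Yamanouchi (p ∷ []) (zeros p)
yamanouchi-oneRow p = record
  { length≡sum = trans (length-replicate p) (sym (+-identityʳ p))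
  ; content = content′
  ; lattice = lattice′ }
  where
  content′ : ∀ i → occ i (zeros p) ≡ at (p ∷ []) i
  content′ zero = occ-zeros p
  content′ (suc j) = occ-suc-zeros j p
  lattice′ : Lattice (zeros p)
  lattice′ k i (suc b) lt = subst (_≤ occBefore i k (zeros p)) (sym (occBefore-suc-zeros b k p)) z≤n

-- Letters i+1 ≥ 1 keep the lattice property of w_ν; letters 0 dominate all
-- letters 1 because the p zeros come first and ν₁ ≤ p.
yamanouchi-stackRow : ∀ p ν wν → head0 ν ≤ p → Decreasing ν → Yamanouchi ν wν →
  Yamanouchi (p ∷ ν) (zeros p ++ L.map suc wν)
yamanouchi-stackRow p ν wν ν₁≤p dν y = record
  { length≡sum = trans (length-++ Z) (cong₂ _+_ (length-replicate p) (trans (length-map suc wν) (length≡sum y)))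
  ; content = content′
  ; lattice = lattice′ }
  where
  Z = zeros p
  S = L.map suc wν
  content′ : ∀ i → occ i (Z ++ S) ≡ at (p ∷ ν) i
  content′ zero = trans (occ-++ 0 Z S) (trans (cong₂ _+_ (occ-zeros p) (occ-zero-map-suc wν)) (+-identityʳ p))
  content′ (suc j) = trans (occ-++ (suc j) Z S) (cong₂ _+_ (occ-suc-zeros j p) (trans (occ-map-suc j wν) (content y j)))
  split : ∀ i k → occBefore i k (Z ++ S) ≡ occBefore i k Z + occBefore i (k ∸ p) S
  split i k = trans (occBefore-++ i k Z S) (cong (λ z → occBefore i k Z + occBefore i (k ∸ z) S) (length-replicate p))
  occBefore-shifted : ∀ j k → occBefore (suc j) k (Z ++ S) ≡ occBefore j (k ∸ p) wν
  occBefore-shifted j k = trans (split (suc j) k) (cong₂ _+_ (occBefore-suc-zeros j k p) (occBefore-map-suc j (k ∸ p) wν))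
  occBefore-zero : ∀ k → occBefore 0 k (Z ++ S) ≡ occBefore 0 k Z
  occBefore-zero k = trans (split 0 k) (trans (cong (occBefore 0 k Z +_) (occBefore-zero-map-suc (k ∸ p) wν)) (+-identityʳ _))
  zeros-dominate : ∀ b k → occBefore b (k ∸ p) wν ≤ occBefore 0 k Z
  zeros-dominate b k with p ≤? k
  ... | yes p≤k = begin
    occBefore b (k ∸ p) wν    ≤⟨ occBefore≤occ b (k ∸ p) wν ⟩
    occ b wν                  ≡⟨ content y b ⟩
    at ν b                    ≤⟨ at≤head0 ν dν b ⟩
    head0 ν                   ≤⟨ ν₁≤p ⟩
    p                         ≡⟨ sym (occ-zeros p) ⟩
    occ 0 Z                   ≡⟨ sym (occBefore-all 0 k Z (subst (_≤ k) (sym (length-replicate p)) p≤k)) ⟩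
    occBefore 0 k Z           ∎
    where open ≤-Reasoning
  ... | no p≰k = subst (λ z → occBefore b z wν ≤ occBefore 0 k Z) (sym (m≤n⇒m∸n≡0 (<⇒≤ (≰⇒> p≰k)))) z≤n
  lattice′ : Lattice (Z ++ S)
  lattice′ k zero (suc b) _ = subst₂ _≤_ (sym (occBefore-shifted b k)) (sym (occBefore-zero k)) (zeros-dominate b k)
  lattice′ k (suc a) (suc b) (s≤s a<b) =
    subst₂ _≤_ (sym (occBefore-shifted b k)) (sym (occBefore-shifted a k)) (lattice y (k ∸ p) a b a<b)

b2n-<?-anti : ∀ m {i i′} → i < i′ → b2n (does (i′ <? m)) ≤ b2n (does (i <? m))
b2n-<?-anti m {i} {i′} lt = compare (i′ <? m) (i <? m)
  where
  compare : (d : Dec (i′ < m)) (d′ : Dec (i < m)) → b2n (does d) ≤ b2n (does d′)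
  compare (no _) _ = z≤n
  compare (yes _) (yes _) = ≤-refl
  compare (yes p) (no np) = ⊥-elim (np (<-trans lt p))

-- Within the first λ'₁ letters the lattice property is that of
-- 0,1,…; afterwards each letter i < λ'₁ has gained exactly one occurrence,
-- and letters i′ ≥ λ'₁ do not occur at all.
yamanouchi-addColumn : ∀ ps wμ → Positive ps → Decreasing ps → Yamanouchi (dropColumn ps) wμ →
  Yamanouchi ps (range 0 (length ps) ++ wμ)
yamanouchi-addColumn ps wμ pos dec y = record
  { length≡sum = trans (length-++ R) (trans (cong₂ _+_ (length-range 0 r) (length≡sum y)) (length+sum-dropColumn ps pos dec))
  ; content = content′
  ; lattice = lattice′ }
  where
  r = length ps
  R = range 0 r
  [i<_] : ℕ → ℕ → ℕ
  [i< m ] i = b2n (does (i <? m))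
  split : ∀ i k → occBefore i k (R ++ wμ) ≡ [i< k ⊓ r ] i + occBefore i (k ∸ r) wμ
  split i k = trans (occBefore-++ i k R wμ) (cong₂ _+_ (occBefore-range 0 i k r) (cong (λ z → occBefore i (k ∸ z) wμ) (length-range 0 r)))
  content′ : ∀ i → occ i (R ++ wμ) ≡ at ps i
  content′ i = begin
    occ i (R ++ wμ)                       ≡⟨ occ-++ i R wμ ⟩
    occ i R + occ i wμ                    ≡⟨ cong (_+ occ i wμ) (sym (occBefore-all i r R (≤-reflexive (length-range 0 r)))) ⟩
    occBefore i r R + occ i wμ            ≡⟨ cong₂ _+_ (trans (occBefore-range 0 i r r) (cong (λ z → [i< z ] i) (⊓-idem r))) (content y i) ⟩
    [i< r ] i + at (dropColumn ps) i      ≡⟨ sym (at-dropColumn ps pos dec i) ⟩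
    at ps i                               ∎
    where open ≡-Reasoning
  absent : ∀ i′ → r ≤ i′ → ∀ k → occBefore i′ k wμ ≡ 0
  absent i′ r≤i′ k = n≤0⇒n≡0 (begin
    occBefore i′ k wμ   ≤⟨ occBefore≤occ i′ k wμ ⟩
    occ i′ wμ           ≡⟨ content y i′ ⟩
    at (dropColumn ps) i′ ≡⟨ at-beyond (dropColumn ps) i′ (≤-trans (length-dropColumn≤ ps) r≤i′) ⟩
    0                   ∎)
    where open ≤-Reasoning
  after-column : ∀ k i i′ → i < i′ → r ≤ k → [i< r ] i′ + occBefore i′ (k ∸ r) wμ ≤ [i< r ] i + occBefore i (k ∸ r) wμ
  after-column k i i′ i<i′ r≤k with i′ <? r
  ... | yes i′<r rewrite dec-true (i′ <? r) i′<r | dec-true (i <? r) (<-trans i<i′ i′<r) =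
    s≤s (lattice y (k ∸ r) i i′ i<i′)
  ... | no i′≮r rewrite dec-false (i′ <? r) i′≮r | absent i′ (≮⇒≥ i′≮r) (k ∸ r) = z≤n
  lattice′ : Lattice (R ++ wμ)
  lattice′ k i i′ i<i′ = subst₂ _≤_ (sym (split i′ k)) (sym (split i k)) bound
    where
    bound : [i< k ⊓ r ] i′ + occBefore i′ (k ∸ r) wμ ≤ [i< k ⊓ r ] i + occBefore i (k ∸ r) wμ
    bound with k ≤? r
    ... | yes k≤r rewrite m≤n⇒m∸n≡0 k≤r = +-monoˡ-≤ 0 (b2n-<?-anti (k ⊓ r) i<i′)
    ... | no k≰r rewrite m≥n⇒m⊓n≡n (<⇒≤ (≰⇒> k≰r)) = after-column k i i′ i<i′ (<⇒≤ (≰⇒> k≰r))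

-- Induction on n (through a fuel bound); for
-- λ = (λ₁, λ₂, …) with at least two rows:
--   d ≤ 1 + (λ₃ + λ₄ + …):  stack the first row on a word for (λ₂, λ₃, …)
--                            with d − 1 ascents;
--   otherwise (then λ₁ ≥ 2): add the first column to a word for
--                            dropColumn λ with d − (λ'₁ − 1) ascents.

Attainable : List ℕ → ℕ → Set
Attainable ps d = Σ (List ℕ) (λ w → Yamanouchi ps w × ascents w ≡ d)

AllAttainable : ℕ → Set
AllAttainable fuel = ∀ ps → sum ps ≤ fuel → Positive ps → Decreasing ps → 0 < length ps → ∀ d →
  length ps ∸ 1 ≤ d → d ≤ sum ps ∸ head0 ps → Attainable ps d

attainable-stackRow : ∀ fuel → AllAttainable fuel → ∀ p′ q qs → sum (suc p′ ∷ q ∷ qs) ≤ suc fuel →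
  Positive (suc p′ ∷ q ∷ qs) → Decreasing (suc p′ ∷ q ∷ qs) → ∀ d →
  suc (length qs) ≤ d → d ≤ suc (sum qs) → Attainable (suc p′ ∷ q ∷ qs) d
attainable-stackRow fuel ih p′ q qs bound (_ ∷ q≥1 ∷ pos) (q≤p ∷ dec) d lo hi =
  extend (ih (q ∷ qs) bound′ (q≥1 ∷ pos) dec z<s (pred d) (pred-mono-≤ lo) hi′)
  where
  bound′ : q + sum qs ≤ fuel
  bound′ = ≤-pred (≤-trans (s≤s (m≤n+m (q + sum qs) p′)) bound)
  hi′ : pred d ≤ (q + sum qs) ∸ q
  hi′ = subst (pred d ≤_) (sym (m+n∸m≡n q (sum qs))) (pred-mono-≤ hi)
  extend : Attainable (q ∷ qs) (pred d) → Attainable (suc p′ ∷ q ∷ qs) d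
  extend (wν , yν , asc) with yamanouchi-∷ yν (≤-trans q≥1 (m≤m+n q (sum qs)))
  ... | ys , refl = zeros (suc p′) ++ L.map suc (0 ∷ ys) ,
    yamanouchi-stackRow (suc p′) (q ∷ qs) (0 ∷ ys) q≤p dec yν ,
    (begin
      ascents (zeros (suc p′) ++ 1 ∷ L.map suc ys) ≡⟨ ascents-zeros-++ p′ 0 (L.map suc ys) ⟩
      suc (ascents (L.map suc (0 ∷ ys)))          ≡⟨ cong suc (ascents-map-suc (0 ∷ ys)) ⟩
      suc (ascents (0 ∷ ys))                      ≡⟨ cong suc asc ⟩
      suc (pred d)                                ≡⟨ suc-pred-pos (<-≤-trans z<s lo) ⟩
      d                                           ∎)
    where open ≡-Reasoning

attainable-addColumn : ∀ fuel → AllAttainable fuel → ∀ p′ q qs → sum (suc (suc p′) ∷ q ∷ qs) ≤ suc fuel →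
  Positive (suc (suc p′) ∷ q ∷ qs) → Decreasing (suc (suc p′) ∷ q ∷ qs) → ∀ d →
  suc (suc (sum qs)) ≤ d → d ≤ q + sum qs → Attainable (suc (suc p′) ∷ q ∷ qs) d
attainable-addColumn fuel ih p′ q qs bound pos@(_ ∷ q≥1 ∷ pos′) dec@(_ ∷ dec′) d lo hi =
  extend (ih μ bound′ (dropColumn-positive ps) (dropColumn-decreasing ps dec) z<s (d ∸ suc L) lo′ hi′)
  where
  ps = suc (suc p′) ∷ q ∷ qs
  μ = dropColumn ps
  L = length qs
  M = length (dropColumn (q ∷ qs))
  bound′ : sum μ ≤ fuel
  bound′ = ≤-pred (≤-trans (≤-trans (s≤s (m≤n+m (sum μ) (suc L))) (≤-reflexive (length+sum-dropColumn ps pos dec))) bound)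
  -- μ has at most M + 1 rows, and M + 1 + L ≤ 2 + (λ₃ + λ₄ + …) < d.
  rows : M + suc L ≤ d
  rows = begin
    M + suc L                                 ≤⟨ +-monoˡ-≤ (suc L) (length-dropColumn-∷ q qs) ⟩
    suc (length (dropColumn qs)) + suc L      ≡⟨ cong suc (trans (+-suc _ L) (cong suc (+-comm _ L))) ⟩
    suc (suc (L + length (dropColumn qs)))    ≤⟨ s≤s (s≤s (length+length-dropColumn≤sum qs pos′)) ⟩
    suc (suc (sum qs))                        ≤⟨ lo ⟩
    d                                         ∎
    where open ≤-Reasoning
  lo′ : length μ ∸ 1 ≤ d ∸ suc L
  lo′ = m+n≤o⇒m≤o∸n M rows
  hi′ : d ∸ suc L ≤ sum μ ∸ head0 μ
  hi′ = subst (d ∸ suc L ≤_) (sym (m+n∸m≡n (suc p′) (sum (dropColumn (q ∷ qs)))))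
          (≤-trans (∸-monoˡ-≤ (suc L) (subst (d ≤_) (sym (length+sum-dropColumn (q ∷ qs) (q≥1 ∷ pos′) dec′)) hi))
                   (≤-reflexive (m+n∸m≡n (suc L) _)))
  extend : Attainable μ (d ∸ suc L) → Attainable ps d
  extend (wμ , yμ , asc) with yamanouchi-∷ yμ z<s
  ... | ys , refl = range 0 (length ps) ++ 0 ∷ ys ,
    yamanouchi-addColumn ps (0 ∷ ys) pos dec yμ ,
    (begin
      ascents (range 0 (suc (suc L)) ++ 0 ∷ ys) ≡⟨ ascents-range-++ 0 (suc L) ys ⟩
      suc L + ascents (0 ∷ ys)                  ≡⟨ cong (suc L +_) asc ⟩
      suc L + (d ∸ suc L)                       ≡⟨ m+[n∸m]≡n (≤-trans (m≤n+m (suc L) M) rows) ⟩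
      d                                         ∎)
    where open ≡-Reasoning

all-attainable : ∀ fuel → AllAttainable fuel
all-attainable fuel (p ∷ []) _ _ _ _ d _ hi =
  zeros p , yamanouchi-oneRow p ,
  trans (ascents-zeros p) (sym (n≤0⇒n≡0 (subst (d ≤_) (trans (cong (_∸ p) (+-identityʳ p)) (n∸n≡0 p)) hi)))
all-attainable fuel (zero ∷ q ∷ qs) _ (() ∷ _) _ _ d lo hi
all-attainable zero (suc p ∷ q ∷ qs) () _ _ _ d lo hi
all-attainable (suc fuel) (suc p′ ∷ q ∷ qs) bound pos dec _ d lo hi with d ≤? suc (sum qs)
... | yes d≤ = attainable-stackRow fuel (all-attainable fuel) p′ q qs bound pos dec d lo d≤
all-attainable (suc fuel) (suc zero ∷ q ∷ qs) _ (_ ∷ q≥1 ∷ _) (q≤1 ∷ _) _ d lo hi | no d≰ =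
  ⊥-elim (d≰ (subst (λ z → d ≤ z + sum qs) (≤-antisym q≤1 q≥1) hi))
all-attainable (suc fuel) (suc (suc p′) ∷ q ∷ qs) bound pos dec _ d lo hi | no d≰ =
  attainable-addColumn fuel (all-attainable fuel) p′ q qs bound pos dec d (≰⇒> d≰)
    (subst (d ≤_) (m+n∸m≡n (suc (suc p′)) (q + sum qs)) hi)

des-bounds : ∀ {n′} (λp : Partition (suc n′)) (T : SYT λp) →
  (numRows λp ∸ 1 ≤ des T) × (des T ≤ suc n′ ∸ firstRow λp)
des-bounds λp T = FirstColumn.des-lower-bound T ,
  subst (λ m → des T ≤ _ ∸ m) (trans (lookup-first≡head0 (parts λp) _) (sym (firstRow≡head0 λp)))
    (FirstRow.des-upper-bound T)

des-attained : ∀ {n′} (λp : Partition (suc n′)) d →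
  numRows λp ∸ 1 ≤ d → d ≤ suc n′ ∸ firstRow λp → ∃[ T ] (des {λp = λp} T ≡ d)
des-attained {n′} λp d lo hi
  with all-attainable (suc n′) (parts λp) (≤-reflexive (sums λp)) (positive λp) (decreasing λp) (numRows-pos λp) d lo
         (subst₂ (λ a b → d ≤ a ∸ b) (sym (sums λp)) (firstRow≡head0 λp) hi)
... | w , y , asc = WordTableau.tableau λp w len (content y) (lattice y) ,
                    trans (WordTableau.des-tableau λp w len (content y) (lattice y)) asc
  where len = trans (length≡sum y) (sums λp)

corollary5p3 : ∀ {n : ℕ} → 1 ≤ n → (λp : Partition n) →
    (∀ (d : ℕ) → (∃[ T ] (des {λp = λp} T ≡ d)) ⇔ ((numRows λp ∸ 1 ≤ d) × (d ≤ n ∸ firstRow λp)))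
    × NoInternalZeros (CoeffNonzero λp)
corollary5p3 (s≤s z≤n) λp = descent-set , no-internal-zeros
  where
  bounds : ∀ d → ∃[ T ] (des {λp = λp} T ≡ d) → (numRows λp ∸ 1 ≤ d) × (d ≤ _ ∸ firstRow λp)
  bounds d (T , refl) = des-bounds λp T
  descent-set : ∀ d → (∃[ T ] (des {λp = λp} T ≡ d)) ⇔ ((numRows λp ∸ 1 ≤ d) × (d ≤ _ ∸ firstRow λp))
  descent-set d = mk⇔ (bounds d) (λ (lo , hi) → des-attained λp d lo hi)
  no-internal-zeros : NoInternalZeros (CoeffNonzero λp)
  no-internal-zeros i j k i<j j<k nz-i nz-k =
    des-attained λp j (≤-trans (proj₁ (bounds i nz-i)) (<⇒≤ i<j)) (≤-trans (<⇒≤ j<k) (proj₂ (bounds k nz-k)))
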